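{- Let $S(n)$ denote the set of $n$-tuples $(x_1,\ldots,x_n)$ of positive integers with $x_1\leq\cdots\leq x_n$ and $\sigma_2(x_1,\ldots,x_n)=\sigma_n(x_1,\ldots,x_n)$, and write $\overline{1}_k$ for $k$ consecutive entries equal to $1$. Then \begin{align*} S(3)&=\{(2,3,6),(2,4,4),(3,3,3)\};\\ S(4)&=\{(1,2,4,14),(2,2,2,6)\};\\ S(5)&=\{(1,1,2,5,25),(1,1,2,7,11),(1,1,3,3,22),(1,1,3,4,9),(1,2,2,2,18),(1,2,2,4,4),(2,2,2,2,3)\};\\ S(6)&=\{(1,1,1,2,6,39),(1,1,1,2,7,22),(1,1,1,3,4,18),(1,1,1,3,6,8)\};\\ S(7)&=\{(\overline{1}_4,2,7,56),(\overline{1}_4,2,8,31),(\overline{1}_4,2,11,16),(\overline{1}_4,3,4,46),(\overline{1}_4,3,6,12),(\overline{1}_4,4,6,7),(\overline{1}_3,2,2,3,20)\};\\ S(8)&=\{(\overline{1}_5,2,8,76),(\overline{1}_5,2,10,30),(\overline{1}_5,4,4,22),(\overline{1}_4,2,2,3,50),(\overline{1}_3,2,2,2,3,5)\};\\ S(9)&=\{(\overline{1}_6,2,9,99),(\overline{1}_6,2,15,21),(\overline{1}_6,3,5,78),(\overline{1}_6,3,6,29),(\overline{1}_6,3,8,15)\};\\ S(10)&=\{(\overline{1}_7,2,10,125),(\overline{1}_7,2,11,67),(\overline{1}_7,2,13,38),(\overline{1}_7,3,6,51),(\overline{1}_7,3,7,28),(\overline{1}_7,4,4,93),\\ &\qquad(\overline{1}_7,4,5,26),(\overline{1}_7,6,7,7),(\overline{1}_6,2,3,3,21),(\overline{1}_6,3,3,3,8)\};\\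 S(11)&=\{(\overline{1}_8,2,11,154),(\overline{1}_8,2,12,82),(\overline{1}_8,2,13,58),(\overline{1}_8,2,14,46),(\overline{1}_8,2,16,34),(\overline{1}_8,2,18,28),\\ &\qquad(\overline{1}_8,2,19,26),(\overline{1}_8,2,22,22),(\overline{1}_8,3,6,118),(\overline{1}_8,3,7,43),(\overline{1}_8,3,8,28),(\overline{1}_8,3,10,18),\\ &\qquad(\overline{1}_8,3,13,13),(\overline{1}_8,4,5,40),(\overline{1}_8,4,6,22),(\overline{1}_8,4,7,16),(\overline{1}_8,4,8,13),(\overline{1}_8,4,10,10),\\ &\qquad(\overline{1}_8,5,5,19),(\overline{1}_8,6,6,10),(\overline{1}_8,7,7,7),(\overline{1}_7,2,2,4,97),(\overline{1}_7,2,2,5,27),(\overline{1}_7,2,2,6,17),\\ &\qquad(\overline{1}_7,2,2,7,13),(\overline{1}_6,2,2,2,3,11)\};\\ S(12)&=\{(\overline{1}_9,2,12,186),(\overline{1}_9,2,16,46),(\overline{1}_9,2,18,36),(\overline{1}_9,4,6,30),(\overline{1}_9,4,8,16),\\ &\qquad(\overline{1}_9,6,6,12),(\overline{1}_8,2,3,4,18),(\overline{1}_8,2,4,4,10),(\overline{1}_8,2,4,6,6),(\overline{1}_7,2,2,2,2,101)\};\\ S(13)&=\{(\overline{1}_{10},2,13,221),(\overline{1}_{10},2,23,31),(\overline{1}_{10},3,7,166),(\overline{1}_{10},3,12,21),(\overline{1}_{10},4,5,155),\\ &\qquad(\overline{1}_{10},5,5,34),(\overline{1}_9,2,3,3,129),(\overline{1}_9,3,3,3,16),(\overline{1}_8,2,2,4,4,4)\};\\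 S(14)&=\{(\overline{1}_{11},2,14,259),(\overline{1}_{11},2,15,136),(\overline{1}_{11},2,16,95),(\overline{1}_{11},2,19,54),(\overline{1}_{11},3,8,100),\\ &\qquad(\overline{1}_{11},3,10,38),(\overline{1}_{11},4,6,63),(\overline{1}_{11},4,7,34),(\overline{1}_{10},2,2,5,159),(\overline{1}_9,2,2,3,5,5)\};\\ S(15)&=\{(\overline{1}_{12},2,15,300),(\overline{1}_{12},2,16,157),(\overline{1}_{12},2,25,40),(\overline{1}_{12},2,27,36),(\overline{1}_{12},3,8,222),\\ &\qquad(\overline{1}_{12},3,9,79),(\overline{1}_{12},3,13,27),(\overline{1}_{12},3,14,24),(\overline{1}_{12},4,6,105),(\overline{1}_{12},4,13,14),\\ &\qquad(\overline{1}_{11},2,3,4,45),(\overline{1}_{11},2,3,7,12),(\overline{1}_{10},2,2,2,3,33)\};\\ S(16)&=\{(\overline{1}_{13},2,16,344),(\overline{1}_{13},2,22,62),(\overline{1}_{13},4,6,232),(\overline{1}_{13},4,8,38),(\overline{1}_{13},8,8,10),\\ &\qquad(\overline{1}_{12},2,2,6,107),(\overline{1}_{12},2,2,7,46),(\overline{1}_{12},2,3,6,18),(\overline{1}_{11},2,2,2,3,46)\}. \end{align*} In particular, $|S(n)|=3,2,7,4,7,5,5,10,26,10,9,10,13,9$ for $n=3,4,\ldots,16$ respectively. Moreover, $S(n)\neq\emptyset$ for every integer $n\geq 3$.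
   Context: $\sigma_k(x_1,\ldots,x_n)=\sum_{i_1<\cdots<i_k}x_{i_1}\cdots x_{i_k}$ is the $k$-th elementary symmetric polynomial. -}

module Defs where

open import Data.Nat using (ℕ; zero; suc; _≤_; _<_; _*_; _+_)
open import Data.List using (List; []; _∷_; map; length)
open import Data.Nat.ListAction using (sum; product)
import Data.List as L
open import Data.Vec using (Vec; toList; replicate; _++_) renaming ([] to []ᵥ; _∷_ to _∷ᵥ_)
open import Data.List.Relation.Unary.All using (All)
open import Data.List.Relation.Unary.Linked using (Linked)
open import Data.List.Relation.Unary.Unique.Propositional using (Unique)
open import Data.List.Membership.Propositional using (_∈_)
open import Data.Product using (_×_; ∃)
open import Function.Bundles using (_⇔_)
open import Relation.Binary.PropositionalEquality using (_≡_)

choose : ℕ → List ℕ → List (List ℕ)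
choose zero    xs       = [] ∷ []
choose (suc k) []       = []
choose (suc k) (x ∷ xs) = L._++_ (map (x ∷_) (choose k xs)) (choose (suc k) xs)

σ : ℕ → List ℕ → ℕ
σ k xs = sum (map product (choose k xs))

InS : (n : ℕ) → Vec ℕ n → Set
InS n v = All (λ x → 0 < x) (toList v)
        × Linked _≤_ (toList v)
        × σ 2 (toList v) ≡ σ n (toList v)

SIs : (n : ℕ) → List (Vec ℕ n) → Set
SIs n Ls = ∀ (v : Vec ℕ n) → InS n v ⇔ v ∈ Ls

SIsWithCard : (n : ℕ) → List (Vec ℕ n) → ℕ → Set
SIsWithCard n Ls c = SIs n Ls × Unique Ls × length Ls ≡ c

ones : (k : ℕ) → Vec ℕ k
ones k = replicate k 1

S3 : List (Vec ℕ 3)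
S3 =
    (2 ∷ᵥ 3 ∷ᵥ 6 ∷ᵥ []ᵥ)
  ∷ (2 ∷ᵥ 4 ∷ᵥ 4 ∷ᵥ []ᵥ)
  ∷ (3 ∷ᵥ 3 ∷ᵥ 3 ∷ᵥ []ᵥ)
  ∷ []

S4 : List (Vec ℕ 4)
S4 =
    (1 ∷ᵥ 2 ∷ᵥ 4 ∷ᵥ 14 ∷ᵥ []ᵥ)
  ∷ (2 ∷ᵥ 2 ∷ᵥ 2 ∷ᵥ 6 ∷ᵥ []ᵥ)
  ∷ []

S5 : List (Vec ℕ 5)
S5 =
    (1 ∷ᵥ 1 ∷ᵥ 2 ∷ᵥ 5 ∷ᵥ 25 ∷ᵥ []ᵥ)
  ∷ (1 ∷ᵥ 1 ∷ᵥ 2 ∷ᵥ 7 ∷ᵥ 11 ∷ᵥ []ᵥ)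
  ∷ (1 ∷ᵥ 1 ∷ᵥ 3 ∷ᵥ 3 ∷ᵥ 22 ∷ᵥ []ᵥ)
  ∷ (1 ∷ᵥ 1 ∷ᵥ 3 ∷ᵥ 4 ∷ᵥ 9 ∷ᵥ []ᵥ)
  ∷ (1 ∷ᵥ 2 ∷ᵥ 2 ∷ᵥ 2 ∷ᵥ 18 ∷ᵥ []ᵥ)
  ∷ (1 ∷ᵥ 2 ∷ᵥ 2 ∷ᵥ 4 ∷ᵥ 4 ∷ᵥ []ᵥ)
  ∷ (2 ∷ᵥ 2 ∷ᵥ 2 ∷ᵥ 2 ∷ᵥ 3 ∷ᵥ []ᵥ)
  ∷ []

S6 : List (Vec ℕ 6)
S6 =
    (1 ∷ᵥ 1 ∷ᵥ 1 ∷ᵥ 2 ∷ᵥ 6 ∷ᵥ 39 ∷ᵥ []ᵥ)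
  ∷ (1 ∷ᵥ 1 ∷ᵥ 1 ∷ᵥ 2 ∷ᵥ 7 ∷ᵥ 22 ∷ᵥ []ᵥ)
  ∷ (1 ∷ᵥ 1 ∷ᵥ 1 ∷ᵥ 3 ∷ᵥ 4 ∷ᵥ 18 ∷ᵥ []ᵥ)
  ∷ (1 ∷ᵥ 1 ∷ᵥ 1 ∷ᵥ 3 ∷ᵥ 6 ∷ᵥ 8 ∷ᵥ []ᵥ)
  ∷ []

S7 : List (Vec ℕ 7)
S7 =
    (ones 4 ++ (2 ∷ᵥ 7 ∷ᵥ 56 ∷ᵥ []ᵥ))
  ∷ (ones 4 ++ (2 ∷ᵥ 8 ∷ᵥ 31 ∷ᵥ []ᵥ))
  ∷ (ones 4 ++ (2 ∷ᵥ 11 ∷ᵥ 16 ∷ᵥ []ᵥ))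
  ∷ (ones 4 ++ (3 ∷ᵥ 4 ∷ᵥ 46 ∷ᵥ []ᵥ))
  ∷ (ones 4 ++ (3 ∷ᵥ 6 ∷ᵥ 12 ∷ᵥ []ᵥ))
  ∷ (ones 4 ++ (4 ∷ᵥ 6 ∷ᵥ 7 ∷ᵥ []ᵥ))
  ∷ (ones 3 ++ (2 ∷ᵥ 2 ∷ᵥ 3 ∷ᵥ 20 ∷ᵥ []ᵥ))
  ∷ []

S8 : List (Vec ℕ 8)
S8 =
    (ones 5 ++ (2 ∷ᵥ 8 ∷ᵥ 76 ∷ᵥ []ᵥ))
  ∷ (ones 5 ++ (2 ∷ᵥ 10 ∷ᵥ 30 ∷ᵥ []ᵥ))
  ∷ (ones 5 ++ (4 ∷ᵥ 4 ∷ᵥ 22 ∷ᵥ []ᵥ))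
  ∷ (ones 4 ++ (2 ∷ᵥ 2 ∷ᵥ 3 ∷ᵥ 50 ∷ᵥ []ᵥ))
  ∷ (ones 3 ++ (2 ∷ᵥ 2 ∷ᵥ 2 ∷ᵥ 3 ∷ᵥ 5 ∷ᵥ []ᵥ))
  ∷ []

S9 : List (Vec ℕ 9)
S9 =
    (ones 6 ++ (2 ∷ᵥ 9 ∷ᵥ 99 ∷ᵥ []ᵥ))
  ∷ (ones 6 ++ (2 ∷ᵥ 15 ∷ᵥ 21 ∷ᵥ []ᵥ))
  ∷ (ones 6 ++ (3 ∷ᵥ 5 ∷ᵥ 78 ∷ᵥ []ᵥ))
  ∷ (ones 6 ++ (3 ∷ᵥ 6 ∷ᵥ 29 ∷ᵥ []ᵥ))
  ∷ (ones 6 ++ (3 ∷ᵥ 8 ∷ᵥ 15 ∷ᵥ []ᵥ))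
  ∷ []

S10 : List (Vec ℕ 10)
S10 =
    (ones 7 ++ (2 ∷ᵥ 10 ∷ᵥ 125 ∷ᵥ []ᵥ))
  ∷ (ones 7 ++ (2 ∷ᵥ 11 ∷ᵥ 67 ∷ᵥ []ᵥ))
  ∷ (ones 7 ++ (2 ∷ᵥ 13 ∷ᵥ 38 ∷ᵥ []ᵥ))
  ∷ (ones 7 ++ (3 ∷ᵥ 6 ∷ᵥ 51 ∷ᵥ []ᵥ))
  ∷ (ones 7 ++ (3 ∷ᵥ 7 ∷ᵥ 28 ∷ᵥ []ᵥ))
  ∷ (ones 7 ++ (4 ∷ᵥ 4 ∷ᵥ 93 ∷ᵥ []ᵥ))
  ∷ (ones 7 ++ (4 ∷ᵥ 5 ∷ᵥ 26 ∷ᵥ []ᵥ))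
  ∷ (ones 7 ++ (6 ∷ᵥ 7 ∷ᵥ 7 ∷ᵥ []ᵥ))
  ∷ (ones 6 ++ (2 ∷ᵥ 3 ∷ᵥ 3 ∷ᵥ 21 ∷ᵥ []ᵥ))
  ∷ (ones 6 ++ (3 ∷ᵥ 3 ∷ᵥ 3 ∷ᵥ 8 ∷ᵥ []ᵥ))
  ∷ []

S11 : List (Vec ℕ 11)
S11 =
    (ones 8 ++ (2 ∷ᵥ 11 ∷ᵥ 154 ∷ᵥ []ᵥ))
  ∷ (ones 8 ++ (2 ∷ᵥ 12 ∷ᵥ 82 ∷ᵥ []ᵥ))
  ∷ (ones 8 ++ (2 ∷ᵥ 13 ∷ᵥ 58 ∷ᵥ []ᵥ))
  ∷ (ones 8 ++ (2 ∷ᵥ 14 ∷ᵥ 46 ∷ᵥ []ᵥ))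
  ∷ (ones 8 ++ (2 ∷ᵥ 16 ∷ᵥ 34 ∷ᵥ []ᵥ))
  ∷ (ones 8 ++ (2 ∷ᵥ 18 ∷ᵥ 28 ∷ᵥ []ᵥ))
  ∷ (ones 8 ++ (2 ∷ᵥ 19 ∷ᵥ 26 ∷ᵥ []ᵥ))
  ∷ (ones 8 ++ (2 ∷ᵥ 22 ∷ᵥ 22 ∷ᵥ []ᵥ))
  ∷ (ones 8 ++ (3 ∷ᵥ 6 ∷ᵥ 118 ∷ᵥ []ᵥ))
  ∷ (ones 8 ++ (3 ∷ᵥ 7 ∷ᵥ 43 ∷ᵥ []ᵥ))
  ∷ (ones 8 ++ (3 ∷ᵥ 8 ∷ᵥ 28 ∷ᵥ []ᵥ))
  ∷ (ones 8 ++ (3 ∷ᵥ 10 ∷ᵥ 18 ∷ᵥ []ᵥ))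
  ∷ (ones 8 ++ (3 ∷ᵥ 13 ∷ᵥ 13 ∷ᵥ []ᵥ))
  ∷ (ones 8 ++ (4 ∷ᵥ 5 ∷ᵥ 40 ∷ᵥ []ᵥ))
  ∷ (ones 8 ++ (4 ∷ᵥ 6 ∷ᵥ 22 ∷ᵥ []ᵥ))
  ∷ (ones 8 ++ (4 ∷ᵥ 7 ∷ᵥ 16 ∷ᵥ []ᵥ))
  ∷ (ones 8 ++ (4 ∷ᵥ 8 ∷ᵥ 13 ∷ᵥ []ᵥ))
  ∷ (ones 8 ++ (4 ∷ᵥ 10 ∷ᵥ 10 ∷ᵥ []ᵥ))
  ∷ (ones 8 ++ (5 ∷ᵥ 5 ∷ᵥ 19 ∷ᵥ []ᵥ))
  ∷ (ones 8 ++ (6 ∷ᵥ 6 ∷ᵥ 10 ∷ᵥ []ᵥ))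
  ∷ (ones 8 ++ (7 ∷ᵥ 7 ∷ᵥ 7 ∷ᵥ []ᵥ))
  ∷ (ones 7 ++ (2 ∷ᵥ 2 ∷ᵥ 4 ∷ᵥ 97 ∷ᵥ []ᵥ))
  ∷ (ones 7 ++ (2 ∷ᵥ 2 ∷ᵥ 5 ∷ᵥ 27 ∷ᵥ []ᵥ))
  ∷ (ones 7 ++ (2 ∷ᵥ 2 ∷ᵥ 6 ∷ᵥ 17 ∷ᵥ []ᵥ))
  ∷ (ones 7 ++ (2 ∷ᵥ 2 ∷ᵥ 7 ∷ᵥ 13 ∷ᵥ []ᵥ))
  ∷ (ones 6 ++ (2 ∷ᵥ 2 ∷ᵥ 2 ∷ᵥ 3 ∷ᵥ 11 ∷ᵥ []ᵥ))
  ∷ []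

S12 : List (Vec ℕ 12)
S12 =
    (ones 9 ++ (2 ∷ᵥ 12 ∷ᵥ 186 ∷ᵥ []ᵥ))
  ∷ (ones 9 ++ (2 ∷ᵥ 16 ∷ᵥ 46 ∷ᵥ []ᵥ))
  ∷ (ones 9 ++ (2 ∷ᵥ 18 ∷ᵥ 36 ∷ᵥ []ᵥ))
  ∷ (ones 9 ++ (4 ∷ᵥ 6 ∷ᵥ 30 ∷ᵥ []ᵥ))
  ∷ (ones 9 ++ (4 ∷ᵥ 8 ∷ᵥ 16 ∷ᵥ []ᵥ))
  ∷ (ones 9 ++ (6 ∷ᵥ 6 ∷ᵥ 12 ∷ᵥ []ᵥ))
  ∷ (ones 8 ++ (2 ∷ᵥ 3 ∷ᵥ 4 ∷ᵥ 18 ∷ᵥ []ᵥ))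
  ∷ (ones 8 ++ (2 ∷ᵥ 4 ∷ᵥ 4 ∷ᵥ 10 ∷ᵥ []ᵥ))
  ∷ (ones 8 ++ (2 ∷ᵥ 4 ∷ᵥ 6 ∷ᵥ 6 ∷ᵥ []ᵥ))
  ∷ (ones 7 ++ (2 ∷ᵥ 2 ∷ᵥ 2 ∷ᵥ 2 ∷ᵥ 101 ∷ᵥ []ᵥ))
  ∷ []

S13 : List (Vec ℕ 13)
S13 =
    (ones 10 ++ (2 ∷ᵥ 13 ∷ᵥ 221 ∷ᵥ []ᵥ))
  ∷ (ones 10 ++ (2 ∷ᵥ 23 ∷ᵥ 31 ∷ᵥ []ᵥ))
  ∷ (ones 10 ++ (3 ∷ᵥ 7 ∷ᵥ 166 ∷ᵥ []ᵥ))
  ∷ (ones 10 ++ (3 ∷ᵥ 12 ∷ᵥ 21 ∷ᵥ []ᵥ))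
  ∷ (ones 10 ++ (4 ∷ᵥ 5 ∷ᵥ 155 ∷ᵥ []ᵥ))
  ∷ (ones 10 ++ (5 ∷ᵥ 5 ∷ᵥ 34 ∷ᵥ []ᵥ))
  ∷ (ones 9 ++ (2 ∷ᵥ 3 ∷ᵥ 3 ∷ᵥ 129 ∷ᵥ []ᵥ))
  ∷ (ones 9 ++ (3 ∷ᵥ 3 ∷ᵥ 3 ∷ᵥ 16 ∷ᵥ []ᵥ))
  ∷ (ones 8 ++ (2 ∷ᵥ 2 ∷ᵥ 4 ∷ᵥ 4 ∷ᵥ 4 ∷ᵥ []ᵥ))
  ∷ []

S14 : List (Vec ℕ 14)
S14 =
    (ones 11 ++ (2 ∷ᵥ 14 ∷ᵥ 259 ∷ᵥ []ᵥ))
  ∷ (ones 11 ++ (2 ∷ᵥ 15 ∷ᵥ 136 ∷ᵥ []ᵥ))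
  ∷ (ones 11 ++ (2 ∷ᵥ 16 ∷ᵥ 95 ∷ᵥ []ᵥ))
  ∷ (ones 11 ++ (2 ∷ᵥ 19 ∷ᵥ 54 ∷ᵥ []ᵥ))
  ∷ (ones 11 ++ (3 ∷ᵥ 8 ∷ᵥ 100 ∷ᵥ []ᵥ))
  ∷ (ones 11 ++ (3 ∷ᵥ 10 ∷ᵥ 38 ∷ᵥ []ᵥ))
  ∷ (ones 11 ++ (4 ∷ᵥ 6 ∷ᵥ 63 ∷ᵥ []ᵥ))
  ∷ (ones 11 ++ (4 ∷ᵥ 7 ∷ᵥ 34 ∷ᵥ []ᵥ))
  ∷ (ones 10 ++ (2 ∷ᵥ 2 ∷ᵥ 5 ∷ᵥ 159 ∷ᵥ []ᵥ))
  ∷ (ones 9 ++ (2 ∷ᵥ 2 ∷ᵥ 3 ∷ᵥ 5 ∷ᵥ 5 ∷ᵥ []ᵥ))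
  ∷ []

S15 : List (Vec ℕ 15)
S15 =
    (ones 12 ++ (2 ∷ᵥ 15 ∷ᵥ 300 ∷ᵥ []ᵥ))
  ∷ (ones 12 ++ (2 ∷ᵥ 16 ∷ᵥ 157 ∷ᵥ []ᵥ))
  ∷ (ones 12 ++ (2 ∷ᵥ 25 ∷ᵥ 40 ∷ᵥ []ᵥ))
  ∷ (ones 12 ++ (2 ∷ᵥ 27 ∷ᵥ 36 ∷ᵥ []ᵥ))
  ∷ (ones 12 ++ (3 ∷ᵥ 8 ∷ᵥ 222 ∷ᵥ []ᵥ))
  ∷ (ones 12 ++ (3 ∷ᵥ 9 ∷ᵥ 79 ∷ᵥ []ᵥ))
  ∷ (ones 12 ++ (3 ∷ᵥ 13 ∷ᵥ 27 ∷ᵥ []ᵥ))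
  ∷ (ones 12 ++ (3 ∷ᵥ 14 ∷ᵥ 24 ∷ᵥ []ᵥ))
  ∷ (ones 12 ++ (4 ∷ᵥ 6 ∷ᵥ 105 ∷ᵥ []ᵥ))
  ∷ (ones 12 ++ (4 ∷ᵥ 13 ∷ᵥ 14 ∷ᵥ []ᵥ))
  ∷ (ones 11 ++ (2 ∷ᵥ 3 ∷ᵥ 4 ∷ᵥ 45 ∷ᵥ []ᵥ))
  ∷ (ones 11 ++ (2 ∷ᵥ 3 ∷ᵥ 7 ∷ᵥ 12 ∷ᵥ []ᵥ))
  ∷ (ones 10 ++ (2 ∷ᵥ 2 ∷ᵥ 2 ∷ᵥ 3 ∷ᵥ 33 ∷ᵥ []ᵥ))
  ∷ []

S16 : List (Vec ℕ 16)
S16 =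
    (ones 13 ++ (2 ∷ᵥ 16 ∷ᵥ 344 ∷ᵥ []ᵥ))
  ∷ (ones 13 ++ (2 ∷ᵥ 22 ∷ᵥ 62 ∷ᵥ []ᵥ))
  ∷ (ones 13 ++ (4 ∷ᵥ 6 ∷ᵥ 232 ∷ᵥ []ᵥ))
  ∷ (ones 13 ++ (4 ∷ᵥ 8 ∷ᵥ 38 ∷ᵥ []ᵥ))
  ∷ (ones 13 ++ (8 ∷ᵥ 8 ∷ᵥ 10 ∷ᵥ []ᵥ))
  ∷ (ones 12 ++ (2 ∷ᵥ 2 ∷ᵥ 6 ∷ᵥ 107 ∷ᵥ []ᵥ))
  ∷ (ones 12 ++ (2 ∷ᵥ 2 ∷ᵥ 7 ∷ᵥ 46 ∷ᵥ []ᵥ))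
  ∷ (ones 12 ++ (2 ∷ᵥ 3 ∷ᵥ 6 ∷ᵥ 18 ∷ᵥ []ᵥ))
  ∷ (ones 11 ++ (2 ∷ᵥ 2 ∷ᵥ 2 ∷ᵥ 3 ∷ᵥ 46 ∷ᵥ []ᵥ))
  ∷ []

-- The quotient σ₂/σₙ = σ₂/∏ of a tuple of positive integers can only decrease when an
-- entry grows, and the equation σ₂ = ∏ is linear in the last entry b:
-- σ₂(p) + (Σ p) b = (∏ p) b.  A depth-first search over sorted prefixes therefore lists
-- every solution among finitely many candidates: a branch is abandoned as soon as the prefix
-- padded with copies of the current entry already has σ₂ < ∏, and the last entry is solved
-- for.  For every n ≥ 3 the prefix p = (1,…,1,2,n) satisfies ∏ p = Σ p + 1,
-- so b = σ₂(p) completes it to a solution.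
module Submission where

open import Defs
open import Data.Nat using (ℕ; _≤_)
open import Data.Vec using (Vec)
open import Data.Product using (_×_; ∃)

open import Data.Nat
open import Data.Nat.Properties
open import Data.Nat.DivMod using (_/_; m*n/n≡m)
open import Data.Nat.ListAction using (sum; product)
open import Data.Nat.ListAction.Properties using (sum-++; product-++)
open import Data.Nat.Solver using (module +-*-Solver)
open import Data.List using (List; []; _∷_; _++_; _∷ʳ_; [_]; map; length; replicate)
import Data.List.Properties
open import Data.List.Properties using (map-++; ++-assoc; ++-identityʳ; ∷ʳ-++)
open import Data.List.Membership.Propositional using (_∈_)
open import Data.List.Membership.Propositional.Properties using (∈-++⁺ˡ; ∈-++⁺ʳ; ∈-map⁻)
open import Data.List.Membership.DecPropositional (Data.List.Properties.≡-dec _≟_) using (_∈?_)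
open import Data.List.Relation.Unary.Any using (here)
open import Data.List.Relation.Unary.All as All using (All; []; _∷_)
import Data.List.Relation.Unary.All.Properties as All
open import Data.List.Relation.Unary.Linked as Linked using (Linked; []; [-]; _∷_; linked?)
open import Data.List.Relation.Unary.Linked.Properties using (Linked⇒All)
open import Data.List.Relation.Unary.Unique.Propositional using (Unique)
import Data.List.Relation.Unary.Unique.DecPropositional as Unique
open import Data.List.Relation.Binary.Pointwise as Pointwise using (Pointwise; []; _∷_)
open import Data.Maybe using (Maybe; just; nothing; zipWith)
import Data.Maybe.Relation.Unary.All as Maybe using (All; just; nothing)
import Data.Maybe.Relation.Unary.Any as Maybe using (Any; just) renaming (dec to any?)
open import Data.Vec using (toList) renaming (_++_ to _++ᵥ_; [] to []ᵥ; _∷_ to _∷ᵥ_)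
import Data.Vec.Properties
open import Data.Vec.Properties using (length-toList; toList-injective; cast-is-id; toList-++; toList-replicate)
open import Data.Product using (_,_)
open import Data.Sum using (inj₁; inj₂)
open import Data.Empty using (⊥-elim)
open import Function using (_∘_)
open import Function.Bundles using (_⇔_; mk⇔; Equivalence)
open import Relation.Nullary using (yes; no; Dec)
open import Relation.Nullary.Decidable using (_×-dec_; _→-dec_; True; toWitness)
open import Relation.Binary.PropositionalEquality hiding ([_])
open +-*-Solver using (solve; _:+_; _:*_; _:=_; con)

σ₂ : List ℕ → ℕ
σ₂ []       = 0
σ₂ (x ∷ xs) = x * sum xs + σ₂ xs

sum-map-product-∷ : ∀ x (C : List (List ℕ)) →
                    sum (map product (map (x ∷_) C)) ≡ x * sum (map product C)
sum-map-product-∷ x []      = sym (*-zeroʳ x)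
sum-map-product-∷ x (c ∷ C) = begin
  x * product c + sum (map product (map (x ∷_) C)) ≡⟨ cong (x * product c +_) (sum-map-product-∷ x C) ⟩
  x * product c + x * sum (map product C)          ≡⟨ *-distribˡ-+ x (product c) _ ⟨
  x * (product c + sum (map product C))            ∎
  where open ≡-Reasoning

σ-∷ : ∀ k x xs → σ (suc k) (x ∷ xs) ≡ x * σ k xs + σ (suc k) xs
σ-∷ k x xs = begin
  sum (map product (map (x ∷_) (choose k xs) ++ choose (suc k) xs))
    ≡⟨ cong sum (map-++ product (map (x ∷_) (choose k xs)) (choose (suc k) xs)) ⟩
  sum (map product (map (x ∷_) (choose k xs)) ++ map product (choose (suc k) xs))
    ≡⟨ sum-++ (map product (map (x ∷_) (choose k xs))) _ ⟩
  sum (map product (map (x ∷_) (choose k xs))) + σ (suc k) xs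
    ≡⟨ cong (_+ σ (suc k) xs) (sum-map-product-∷ x (choose k xs)) ⟩
  x * σ k xs + σ (suc k) xs
    ∎
  where open ≡-Reasoning

σ-1≡sum : ∀ xs → σ 1 xs ≡ sum xs
σ-1≡sum []       = refl
σ-1≡sum (x ∷ xs) = trans (σ-∷ 0 x xs) (cong₂ _+_ (*-identityʳ x) (σ-1≡sum xs))

σ-2≡σ₂ : ∀ xs → σ 2 xs ≡ σ₂ xs
σ-2≡σ₂ []       = refl
σ-2≡σ₂ (x ∷ xs) = trans (σ-∷ 1 x xs) (cong₂ _+_ (cong (x *_) (σ-1≡sum xs)) (σ-2≡σ₂ xs))

σ-length< : ∀ k xs → length xs ≤ k → σ (suc k) xs ≡ 0
σ-length< k       []       _           = refl
σ-length< (suc k) (x ∷ xs) (s≤s |xs|≤k) = begin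
  σ (suc (suc k)) (x ∷ xs)              ≡⟨ σ-∷ (suc k) x xs ⟩
  x * σ (suc k) xs + σ (suc (suc k)) xs ≡⟨ cong₂ _+_ (cong (x *_) (σ-length< k xs |xs|≤k))
                                                     (σ-length< (suc k) xs (m≤n⇒m≤1+n |xs|≤k)) ⟩
  x * 0 + 0                             ≡⟨ cong (_+ 0) (*-zeroʳ x) ⟩
  0                                     ∎
  where open ≡-Reasoning

σ-length≡product : ∀ xs → σ (length xs) xs ≡ product xs
σ-length≡product []       = refl
σ-length≡product (x ∷ xs) = begin
  σ (suc (length xs)) (x ∷ xs)                  ≡⟨ σ-∷ (length xs) x xs ⟩
  x * σ (length xs) xs + σ (suc (length xs)) xs ≡⟨ cong₂ _+_ (cong (x *_) (σ-length≡product xs))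
                                                             (σ-length< (length xs) xs ≤-refl) ⟩
  x * product xs + 0                            ≡⟨ +-identityʳ _ ⟩
  x * product xs                                ∎
  where open ≡-Reasoning

σ₂-++ : ∀ xs ys → σ₂ (xs ++ ys) ≡ σ₂ xs + sum xs * sum ys + σ₂ ys
σ₂-++ []       ys = refl
σ₂-++ (x ∷ xs) ys rewrite sum-++ xs ys | σ₂-++ xs ys =
  solve 5 (λ x s t p q → x :* (s :+ t) :+ (p :+ s :* t :+ q) := x :* s :+ p :+ (x :+ s) :* t :+ q)
        refl x (sum xs) (sum ys) (σ₂ xs) (σ₂ ys)

σ₂-∷ʳ : ∀ xs b → σ₂ (xs ∷ʳ b) ≡ σ₂ xs + sum xs * b
σ₂-∷ʳ xs b rewrite σ₂-++ xs [ b ] =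
  solve 3 (λ p s b → p :+ s :* (b :+ con 0) :+ (b :* con 0 :+ con 0) := p :+ s :* b) refl (σ₂ xs) (sum xs) b

product-∷ʳ : ∀ xs b → product (xs ∷ʳ b) ≡ product xs * b
product-∷ʳ xs b = trans (product-++ xs [ b ]) (cong (product xs *_) (*-identityʳ b))

σ₂-++-≥ʳ : ∀ xs ys → σ₂ ys ≤ σ₂ (xs ++ ys)
σ₂-++-≥ʳ xs ys = ≤-trans (m≤n+m (σ₂ ys) _) (≤-reflexive (sym (σ₂-++ xs ys)))

Solution : List ℕ → Set
Solution xs = All (0 <_) xs × Linked _≤_ xs × σ₂ xs ≡ product xs

solution? : ∀ xs → Dec (Solution xs)
solution? xs = All.all? (0 <?_) xs ×-dec linked? _≤?_ xs ×-dec σ₂ xs ≟ product xs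

σ-n≡product : ∀ {n} (v : Vec ℕ n) → σ n (toList v) ≡ product (toList v)
σ-n≡product v = subst (λ k → σ k (toList v) ≡ product (toList v)) (length-toList v) (σ-length≡product (toList v))

InS⇔Solution : ∀ n (v : Vec ℕ n) → InS n v ⇔ Solution (toList v)
InS⇔Solution n v = mk⇔ (λ (pos , sorted , eq) → pos , sorted , trans (sym (σ-2≡σ₂ (toList v))) (trans eq (σ-n≡product v)))
                       (λ (pos , sorted , eq) → pos , sorted , trans (σ-2≡σ₂ (toList v)) (trans eq (sym (σ-n≡product v))))

∷ʳ-solution⇔ : ∀ xs b → σ₂ (xs ∷ʳ b) ≡ product (xs ∷ʳ b) ⇔ σ₂ xs + sum xs * b ≡ product xs * b
∷ʳ-solution⇔ xs b = mk⇔ (λ eq → trans (sym (σ₂-∷ʳ xs b)) (trans eq (product-∷ʳ xs b)))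
                       (λ eq → trans (σ₂-∷ʳ xs b) (trans eq (sym (product-∷ʳ xs b))))

last-entry-equation : ∀ xs b → σ₂ xs + sum xs * b ≡ product xs * b → b * (product xs ∸ sum xs) ≡ σ₂ xs
last-entry-equation xs b eq = begin
  b * (product xs ∸ sum xs)        ≡⟨ *-distribˡ-∸ b (product xs) (sum xs) ⟩
  b * product xs ∸ b * sum xs      ≡⟨ cong₂ _∸_ (trans (*-comm b (product xs)) (sym eq)) (*-comm b (sum xs)) ⟩
  σ₂ xs + sum xs * b ∸ sum xs * b  ≡⟨ m+n∸n≡m (σ₂ xs) (sum xs * b) ⟩
  σ₂ xs                            ∎
  where open ≡-Reasoning

last-entry-solves : ∀ xs → product xs ≡ suc (sum xs) → σ₂ (xs ∷ʳ σ₂ xs) ≡ product (xs ∷ʳ σ₂ xs)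
last-entry-solves xs ∏≡1+S = Equivalence.from (∷ʳ-solution⇔ xs (σ₂ xs)) (begin
  σ₂ xs + sum xs * σ₂ xs  ≡⟨⟩
  suc (sum xs) * σ₂ xs    ≡⟨ cong (_* σ₂ xs) ∏≡1+S ⟨
  product xs * σ₂ xs      ∎)
  where open ≡-Reasoning

product-mono-≤ : ∀ {ys zs} → Pointwise _≤_ ys zs → product ys ≤ product zs
product-mono-≤ []       = ≤-refl
product-mono-≤ (p ∷ ps) = *-mono-≤ p (product-mono-≤ ps)

sum*product-antitone : ∀ {ys zs} → Pointwise _≤_ ys zs → sum zs * product ys ≤ sum ys * product zs
sum*product-antitone []                         = ≤-refl
sum*product-antitone {y ∷ ys} {z ∷ zs} (y≤z ∷ ps) = begin
  (z + sum zs) * (y * product ys)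
    ≡⟨ solve 4 (λ z t y q → (z :+ t) :* (y :* q) := y :* (z :* q) :+ y :* (t :* q))
             refl z (sum zs) y (product ys) ⟩
  y * (z * product ys) + y * (sum zs * product ys)
    ≤⟨ +-mono-≤ (*-monoʳ-≤ y (*-monoʳ-≤ z (product-mono-≤ ps))) (*-mono-≤ y≤z (sum*product-antitone ps)) ⟩
  y * (z * product zs) + z * (sum ys * product zs)
    ≡⟨ solve 4 (λ z s y r → y :* (z :* r) :+ z :* (s :* r) := (y :+ s) :* (z :* r))
             refl z (sum ys) y (product zs) ⟩
  (y + sum ys) * (z * product zs)
    ∎
  where open ≤-Reasoning

σ₂*product-antitone : ∀ {ys zs} → Pointwise _≤_ ys zs → σ₂ zs * product ys ≤ σ₂ ys * product zs
σ₂*product-antitone []                         = ≤-refl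
σ₂*product-antitone {y ∷ ys} {z ∷ zs} (y≤z ∷ ps) = begin
  (z * sum zs + σ₂ zs) * (y * product ys)
    ≡⟨ solve 5 (λ z t p y q → (z :* t :+ p) :* (y :* q) := (y :* z) :* (t :* q) :+ y :* (p :* q))
             refl z (sum zs) (σ₂ zs) y (product ys) ⟩
  (y * z) * (sum zs * product ys) + y * (σ₂ zs * product ys)
    ≤⟨ +-mono-≤ (*-monoʳ-≤ (y * z) (sum*product-antitone ps)) (*-mono-≤ y≤z (σ₂*product-antitone ps)) ⟩
  (y * z) * (sum ys * product zs) + z * (σ₂ ys * product zs)
    ≡⟨ solve 5 (λ z s p y r → (y :* z) :* (s :* r) :+ z :* (p :* r) := (y :* s :+ p) :* (z :* r))
             refl z (sum ys) (σ₂ ys) y (product zs) ⟩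
  (y * sum ys + σ₂ ys) * (z * product zs)
    ∎
  where open ≤-Reasoning

σ₂<product-upward-closed : ∀ {ys zs} → Pointwise _≤_ ys zs → σ₂ ys < product ys → σ₂ zs < product zs
σ₂<product-upward-closed {ys} {zs} ys≤zs σ₂<∏ = *-cancelʳ-< (product ys) (σ₂ zs) (product zs) (begin-strict
  σ₂ zs * product ys       ≤⟨ σ₂*product-antitone ys≤zs ⟩
  σ₂ ys * product zs       <⟨ *-monoˡ-< (product zs) {{>-nonZero ∏zs>0}} σ₂<∏ ⟩
  product ys * product zs  ≡⟨ *-comm (product ys) (product zs) ⟩
  product zs * product ys  ∎)
  where
  open ≤-Reasoning
  ∏zs>0 : 0 < product zs
  ∏zs>0 = <-≤-trans (≤-<-trans z≤n σ₂<∏) (product-mono-≤ ys≤zs)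

last-entry-forced : ∀ xs b .{{_ : NonZero (product xs ∸ sum xs)}} →
                    σ₂ (xs ∷ʳ b) ≡ product (xs ∷ʳ b) → σ₂ xs / (product xs ∸ sum xs) ≡ b
last-entry-forced xs b eq = begin
  σ₂ xs / (product xs ∸ sum xs)                      ≡⟨ cong (_/ (product xs ∸ sum xs))
                                                             (last-entry-equation xs b (Equivalence.to (∷ʳ-solution⇔ xs b) eq)) ⟨
  b * (product xs ∸ sum xs) / (product xs ∸ sum xs)  ≡⟨ m*n/n≡m b (product xs ∸ sum xs) ⟩
  b                                                  ∎
  where open ≡-Reasoning

product≤sum⇒σ₂≡0 : ∀ xs b → product xs ≤ sum xs → σ₂ (xs ∷ʳ b) ≡ product (xs ∷ʳ b) → σ₂ xs ≡ 0
product≤sum⇒σ₂≡0 xs b ∏≤Σ eq = n≤0⇒n≡0 (+-cancelʳ-≤ (sum xs * b) (σ₂ xs) 0 (begin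
  σ₂ xs + sum xs * b  ≡⟨ Equivalence.to (∷ʳ-solution⇔ xs b) eq ⟩
  product xs * b      ≤⟨ *-monoˡ-≤ b ∏≤Σ ⟩
  sum xs * b          ∎))
  where open ≤-Reasoning

no-two-entry-completion : ∀ pre a b → product pre ≡ 1 → 0 < sum pre → 0 < a →
                          σ₂ (pre ++ a ∷ b ∷ []) ≢ product (pre ++ a ∷ b ∷ [])
no-two-entry-completion pre a b ∏≡1 S>0 a>0 eq = <-irrefl (sym eq) (begin-strict
  product (pre ++ a ∷ b ∷ [])                                     ≡⟨ product-++ pre (a ∷ b ∷ []) ⟩
  product pre * (a * (b * 1))                                     ≡⟨ cong (_* (a * (b * 1))) ∏≡1 ⟩
  1 * (a * (b * 1))                                               ≡⟨ solve 2 (λ a b → con 1 :* (a :* (b :* con 1)) := a :* b) refl a b ⟩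
  a * b                                                           <⟨ m<n+m (a * b) rest>0 ⟩
  σ₂ pre + sum pre * (a + b) + a * b                              ≡⟨ solve 4 (λ p s a b → p :+ s :* (a :+ b) :+ a :* b
                                                                                  := p :+ s :* (a :+ (b :+ con 0)) :+ (a :* (b :+ con 0) :+ (b :* con 0 :+ con 0)))
                                                                             refl (σ₂ pre) (sum pre) a b ⟩
  σ₂ pre + sum pre * (a + (b + 0)) + (a * (b + 0) + (b * 0 + 0))  ≡⟨ σ₂-++ pre (a ∷ b ∷ []) ⟨
  σ₂ (pre ++ a ∷ b ∷ [])                                          ∎)
  where
  open ≤-Reasoning
  rest>0 : 0 < σ₂ pre + sum pre * (a + b)
  rest>0 = ≤-trans (*-mono-≤ S>0 (≤-trans a>0 (m≤m+n a b))) (m≤n+m _ (σ₂ pre))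

Covers : ℕ → List ℕ → ℕ → List (List ℕ) → Set
Covers k pre lo R = ∀ rest → length rest ≡ k → All (lo ≤_) rest → Linked _≤_ rest →
                    σ₂ (pre ++ rest) ≡ product (pre ++ rest) → pre ++ rest ∈ R

-- The candidate is not checked to be a solution: Enumerates filters the candidates.  When
-- ∏ pre ≤ Σ pre, a completion forces σ₂ pre = 0, and in that case the search gives up.
lastEntry : List ℕ → Maybe (List (List ℕ))
lastEntry pre with sum pre <? product pre
... | yes S<P = just [ pre ∷ʳ _/_ (σ₂ pre) (product pre ∸ sum pre) {{>-nonZero (m<n⇒0<n∸m S<P)}} ]
... | no _ with σ₂ pre ≟ 0
...   | yes _ = nothing
...   | no _  = just []

search : (fuel k : ℕ) → List ℕ → ℕ → Maybe (List (List ℕ))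
scan   : (fuel r : ℕ) → List ℕ → ℕ → Maybe (List (List ℕ))

search fuel 0 pre lo = just [ pre ]
search fuel 1 pre lo = lastEntry pre
-- With ∏ pre = 1 the pruning test of scan never fires (σ₂ ≥ ∏ there), but no completion exists.
search fuel 2 pre lo with (product pre ≟ 1) ×-dec (0 <? sum pre) ×-dec (0 <? lo)
... | yes _ = just []
... | no _  = scan fuel 0 pre lo
search fuel (suc (suc (suc r))) pre lo = scan fuel (suc r) pre lo

-- scan tries x, x + 1, … as the next entry until the prefix padded with copies of x has
-- σ₂ < ∏, which by σ₂<product-upward-closed rules out every completion by larger entries.
scan zero       r pre x = nothing
scan (suc fuel) r pre x with σ₂ (pre ++ replicate (2 + r) x) <? product (pre ++ replicate (2 + r) x)
... | yes _ = just []
... | no _  = zipWith _++_ (search fuel (suc r) (pre ∷ʳ x) x) (scan fuel r pre (suc x))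

lastEntry-complete : ∀ pre lo → Maybe.All (Covers 1 pre lo) (lastEntry pre)
lastEntry-complete pre lo with sum pre <? product pre
... | yes S<P = Maybe.just λ { (b ∷ []) _ _ _ eq →
                 here (cong (pre ∷ʳ_) (sym (last-entry-forced pre b {{>-nonZero (m<n⇒0<n∸m S<P)}} eq))) }
... | no S≮P with σ₂ pre ≟ 0
...   | yes _   = Maybe.nothing
...   | no σ₂≢0 = Maybe.just λ { (b ∷ []) _ _ _ eq → ⊥-elim (σ₂≢0 (product≤sum⇒σ₂≡0 pre b (≮⇒≥ S≮P) eq)) }

zipWith⁺ : ∀ {A B C : Set} {P : A → Set} {Q : B → Set} {R : C → Set} (f : A → B → C) →
           (∀ {a b} → P a → Q b → R (f a b)) →
           ∀ {ma mb} → Maybe.All P ma → Maybe.All Q mb → Maybe.All R (zipWith f ma mb)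
zipWith⁺ f PQ⇒R (Maybe.just pa) (Maybe.just qb) = Maybe.just (PQ⇒R pa qb)
zipWith⁺ f PQ⇒R (Maybe.just pa) Maybe.nothing   = Maybe.nothing
zipWith⁺ f PQ⇒R Maybe.nothing   _               = Maybe.nothing

replicate≤ : ∀ {x rest} → All (x ≤_) rest → Pointwise _≤_ (replicate (length rest) x) rest
replicate≤ []           = []
replicate≤ (x≤r ∷ x≤rs) = x≤r ∷ replicate≤ x≤rs

covers-pruned : ∀ k pre x {R} → σ₂ (pre ++ replicate k x) < product (pre ++ replicate k x) → Covers k pre x R
covers-pruned k pre x σ₂<∏ rest refl x≤rest _ eq =
  ⊥-elim (<-irrefl eq (σ₂<product-upward-closed (Pointwise.++⁺ˡ ≤-refl pre (replicate≤ x≤rest)) σ₂<∏))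

covers-split : ∀ k pre x {A B} → Covers k (pre ∷ʳ x) x A → Covers (suc k) pre (suc x) B →
               Covers (suc k) pre x (A ++ B)
covers-split k pre x {A} covA covB (a ∷ rest) len (x≤a ∷ _) sorted eq with m≤n⇒m<n∨m≡n x≤a
... | inj₁ x<a  = ∈-++⁺ʳ A (covB (a ∷ rest) len (Linked⇒All ≤-trans x<a sorted) sorted eq)
... | inj₂ refl = ∈-++⁺ˡ (subst (_∈ A) (∷ʳ-++ pre x rest)
                    (covA rest (suc-injective len) (All.tail (Linked⇒All ≤-trans ≤-refl sorted)) (Linked.tail sorted)
                          (subst (λ xs → σ₂ xs ≡ product xs) (sym (∷ʳ-++ pre x rest)) eq)))

search-complete : ∀ fuel k pre lo → Maybe.All (Covers k pre lo) (search fuel k pre lo)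
scan-complete   : ∀ fuel r pre x → Maybe.All (Covers (2 + r) pre x) (scan fuel r pre x)

search-complete fuel 0 pre lo = Maybe.just λ { [] _ _ _ _ → here (++-identityʳ pre) }
search-complete fuel 1 pre lo = lastEntry-complete pre lo
search-complete fuel 2 pre lo with (product pre ≟ 1) ×-dec (0 <? sum pre) ×-dec (0 <? lo)
... | yes (∏≡1 , S>0 , lo>0) = Maybe.just λ { (a ∷ b ∷ []) _ (lo≤a ∷ _) _ eq →
                                  ⊥-elim (no-two-entry-completion pre a b ∏≡1 S>0 (≤-trans lo>0 lo≤a) eq) }
... | no _  = scan-complete fuel 0 pre lo
search-complete fuel (suc (suc (suc r))) pre lo = scan-complete fuel (suc r) pre lo

scan-complete zero       r pre x = Maybe.nothing
scan-complete (suc fuel) r pre x with σ₂ (pre ++ replicate (2 + r) x) <? product (pre ++ replicate (2 + r) x)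
... | yes σ₂<∏ = Maybe.just (covers-pruned (2 + r) pre x σ₂<∏)
... | no _     = zipWith⁺ _++_ (covers-split (suc r) pre x)
                   (search-complete fuel (suc r) (pre ∷ʳ x) x) (scan-complete fuel r pre (suc x))

∈-map-toList⁻ : ∀ {A : Set} {n} {v : Vec A n} {vs} → toList v ∈ map toList vs → v ∈ vs
∈-map-toList⁻ {v = v} {vs} v∈ with ∈-map⁻ toList v∈
... | w , w∈ , v≡w = subst (_∈ vs) (trans (sym (toList-injective refl v w v≡w)) (cast-is-id refl v)) w∈

-- Running out of fuel yields nothing, so an insufficient value only makes enumerates? fail.
searchFuel : ℕ
searchFuel = 300

Enumerates : (n : ℕ) → List (Vec ℕ n) → Set
Enumerates n vs = Maybe.Any (All (λ xs → Solution xs → xs ∈ map toList vs)) (search searchFuel n [] 1)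
                × All (Solution ∘ toList) vs × Unique vs

enumerates? : ∀ n vs → Dec (Enumerates n vs)
enumerates? n vs = Maybe.any? (All.all? (λ xs → solution? xs →-dec xs ∈? map toList vs)) (search searchFuel n [] 1)
                   ×-dec All.all? (solution? ∘ toList) vs ×-dec Unique.unique? (Data.Vec.Properties.≡-dec _≟_) vs

covered∧listed : ∀ {A : Set} {P Q : A → Set} {m} → Maybe.All P m → Maybe.Any Q m → ∃ λ a → P a × Q a
covered∧listed (Maybe.just p) (Maybe.just q) = _ , p , q

enumeration : ∀ n vs → Enumerates n vs → SIsWithCard n vs (length vs)
enumeration n vs (found , sols , uniq) =
  (λ v → mk⇔ (complete v ∘ Equivalence.to (InS⇔Solution n v))
             (λ v∈ → Equivalence.from (InS⇔Solution n v) (All.lookup sols v∈)))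
  , uniq , refl
  where
  complete : ∀ v → Solution (toList v) → v ∈ vs
  complete v sol@(pos , sorted , eq) with covered∧listed (search-complete searchFuel n [] 1) found
  ... | R , covers , listed =
    ∈-map-toList⁻ (All.lookup listed (covers (toList v) (length-toList v) pos sorted eq) sol)

enumerate : ∀ n vs → {True (enumerates? n vs)} → SIsWithCard n vs (length vs)
enumerate n vs {ok} = enumeration n vs (toWitness ok)

sum-replicate-1 : ∀ m → sum (replicate m 1) ≡ m
sum-replicate-1 zero    = refl
sum-replicate-1 (suc m) = cong suc (sum-replicate-1 m)

product-replicate-1 : ∀ m → product (replicate m 1) ≡ 1
product-replicate-1 zero    = refl
product-replicate-1 (suc m) = trans (+-identityʳ _) (product-replicate-1 m)

ones-++-sorted : ∀ m {x xs} → 1 ≤ x → Linked _≤_ (x ∷ xs) → Linked _≤_ (replicate m 1 ++ x ∷ xs)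
ones-++-sorted zero          _   sorted = sorted
ones-++-sorted (suc zero)    1≤x sorted = 1≤x ∷ sorted
ones-++-sorted (suc (suc m)) 1≤x sorted = ≤-refl ∷ ones-++-sorted (suc m) 1≤x sorted

family-prefix : ℕ → List ℕ
family-prefix m = replicate m 1 ++ 2 ∷ 3 + m ∷ []

family-prefix-product : ∀ m → product (family-prefix m) ≡ suc (sum (family-prefix m))
family-prefix-product m
  rewrite product-++ (replicate m 1) (2 ∷ 3 + m ∷ []) | product-replicate-1 m
        | sum-++ (replicate m 1) (2 ∷ 3 + m ∷ []) | sum-replicate-1 m =
  solve 1 (λ m → con 1 :* (con 2 :* ((con 3 :+ m) :* con 1)) := con 1 :+ (m :+ (con 2 :+ ((con 3 :+ m) :+ con 0)))) refl m

family : (m : ℕ) → Vec ℕ (m + 3)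
family m = ones m ++ᵥ (2 ∷ᵥ 3 + m ∷ᵥ σ₂ (family-prefix m) ∷ᵥ []ᵥ)

family-solution : ∀ m → Solution (toList (family m))
family-solution m rewrite toList-++ (ones m) (2 ∷ᵥ 3 + m ∷ᵥ σ₂ (family-prefix m) ∷ᵥ []ᵥ) | toList-replicate m 1 =
    All.++⁺ (All.replicate⁺ m z<s) (z<s ∷ z<s ∷ ≤-trans z<s N≤c ∷ [])
  , ones-++-sorted m (s≤s z≤n) (s≤s (s≤s z≤n) ∷ N≤c ∷ [-])
  , subst (λ xs → σ₂ xs ≡ product xs) (++-assoc (replicate m 1) (2 ∷ N ∷ []) [ c ])
          (last-entry-solves (family-prefix m) (family-prefix-product m))
  where
  N = 3 + m
  c = σ₂ (family-prefix m)
  N≤σ₂[2,N] : N ≤ σ₂ (2 ∷ N ∷ [])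
  N≤σ₂[2,N] = ≤-trans (m≤m+n N 0) (≤-trans (m≤m+n _ _) (m≤m+n _ _))
  N≤c : N ≤ c
  N≤c = ≤-trans N≤σ₂[2,N] (σ₂-++-≥ʳ (replicate m 1) (2 ∷ N ∷ []))

solution-exists : ∀ n → 3 ≤ n → ∃ λ (v : Vec ℕ n) → InS n v
solution-exists n 3≤n = subst (λ k → ∃ λ (v : Vec ℕ k) → InS k v) (m∸n+n≡m 3≤n)
  (family (n ∸ 3) , Equivalence.from (InS⇔Solution _ (family (n ∸ 3))) (family-solution (n ∸ 3)))

theorem2p14 : SIsWithCard 3 S3 3 × SIsWithCard 4 S4 2 × SIsWithCard 5 S5 7
    × SIsWithCard 6 S6 4 × SIsWithCard 7 S7 7 × SIsWithCard 8 S8 5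
    × SIsWithCard 9 S9 5 × SIsWithCard 10 S10 10 × SIsWithCard 11 S11 26
    × SIsWithCard 12 S12 10 × SIsWithCard 13 S13 9 × SIsWithCard 14 S14 10
    × SIsWithCard 15 S15 13 × SIsWithCard 16 S16 9
    × ((n : ℕ) → 3 ≤ n → ∃ λ (v : Vec ℕ n) → InS n v)
theorem2p14 =
    enumerate 3 S3 , enumerate 4 S4 , enumerate 5 S5 , enumerate 6 S6 , enumerate 7 S7
  , enumerate 8 S8 , enumerate 9 S9 , enumerate 10 S10 , enumerate 11 S11 , enumerate 12 S12
  , enumerate 13 S13 , enumerate 14 S14 , enumerate 15 S15 , enumerate 16 S16
  , solution-exists
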